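{- Let $k\geq 2$ be an integer, let $c_{k}=\sqrt{k(k-1)(k+2\sqrt{2k}+2)}$, let $n_{1}(k)$ be the smallest positive integer such that $\frac{n+2k-2}{4}-2c_{k}\sqrt{n}-k^{2}-2k-1\geq 0$ for every integer $n\geq n_{1}(k)$, and let $n$ be an odd integer with $n\geq n_{1}(k)$. Let $A_{0},A_{1},A_{2}$ be vertex-disjoint complete graphs with $|V(A_{0})|=3$ and $|V(A_{1})|=|V(A_{2})|=\frac{n-3}{2}$ (note $\frac{n-3}{2}\geq k+1$ under these assumptions). Write $V(A_{0})=\{u,v_{1},v_{2}\}$, and for each $i\in\{1,2\}$ choose $W_{i}\subseteq V(A_{i})$ with $|W_{i}|=k-1$. Let $G'_{k,n}$ be the graph obtained from $A_0\cup A_1\cup A_2$ by adding the edges $uw$ for all $w\in W_{1}$ and the edges $v_{1}w$, $v_{2}w$ for all $w\in W_{2}$. Then $G'_{k,n}$ has no $[2,k]$-ST.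
   Context: All graphs are finite and simple. A $[2,k]$-ST of a graph $G$ is a spanning tree $T$ of $G$ having no vertex whose degree in $T$ lies in $\{2,3,\dots,k\}$. -}

module Defs where

open import Data.Nat as ℕ using (ℕ; zero; suc; _+_; _*_; _∸_)
open import Data.Integer as ℤ using (ℤ; +_)
open import Data.Fin using (Fin; zero; suc; splitAt; _≟_)
open import Data.Fin.Subset using (Subset)
open import Data.Vec using (lookup)
open import Data.List using (List; []; _∷_; _++_; [_]; length; map; allFin)
open import Data.Nat.ListAction using (sum)
open import Data.List.Relation.Unary.Unique.Propositional using (Unique)
open import Data.Bool using (Bool; true; false; not; if_then_else_)
open import Data.Sum using (_⊎_; inj₁; inj₂)
open import Data.Product using (Σ; _×_; _,_)
open import Data.Unit using (⊤)
open import Relation.Nullary using (¬_)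
open import Relation.Nullary.Decidable using (⌊_⌋)
open import Relation.Binary.PropositionalEquality using (_≡_)

record Graph (N : ℕ) : Set where
  field adj : Fin N → Fin N → Bool
open Graph public

IsSimple : ∀ {N} → Graph N → Set
IsSimple G = (∀ x y → adj G x y ≡ adj G y x) × (∀ x → adj G x x ≡ false)

data Walk {N} (G : Graph N) : Fin N → Fin N → Set where
  here : ∀ {x} → Walk G x x
  step : ∀ {x y z} → adj G x y ≡ true → Walk G y z → Walk G x z

Connected : ∀ {N} → Graph N → Set
Connected {N} G = (x y : Fin N) → Walk G x y

Chain : ∀ {N} → Graph N → List (Fin N) → Set
Chain G [] = ⊤
Chain G (x ∷ []) = ⊤
Chain G (x ∷ y ∷ ys) = (adj G x y ≡ true) × Chain G (y ∷ ys)

HasCycle : ∀ {N} → Graph N → Set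
HasCycle {N} G = Σ (Fin N) λ x → Σ (List (Fin N)) λ ys →
  Unique (x ∷ ys) × (2 ℕ.≤ length ys) × Chain G (x ∷ ys ++ [ x ])

IsTree : ∀ {N} → Graph N → Set
IsTree T = IsSimple T × Connected T × ¬ HasCycle T

Subgraph : ∀ {N} → Graph N → Graph N → Set
Subgraph {N} T G = (x y : Fin N) → adj T x y ≡ true → adj G x y ≡ true

IsSpanningTree : ∀ {N} → Graph N → Graph N → Set
IsSpanningTree G T = Subgraph T G × IsTree T

degree : ∀ {N} → Graph N → Fin N → ℕ
degree {N} T x = sum (map (λ y → if adj T x y then 1 else 0) (allFin N))

Is2kST : ∀ {N} → ℕ → Graph N → Graph N → Set
Is2kST {N} k G T =
  IsSpanningTree G T × ((x : Fin N) → ¬ ((2 ℕ.≤ degree T x) × (degree T x ℕ.≤ k)))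

Has2kST : ∀ {N} → ℕ → Graph N → Set
Has2kST {N} k G = Σ (Graph N) λ T → Is2kST k G T

-- The inequality  (n+2k-2)/4 - 2 c_k √n - k² - 2k - 1 ≥ 0,
-- c_k = √(k(k-1)(k+2√(2k)+2)), rewritten exactly in integer arithmetic:  with M = n+2k-2-4(k+1)²  (= 4·LHS-without-root-term),
--   LHS ≥ 2c_k√n  ⇔  M ≥ 0  ∧  M² ≥ 64 c_k² n
--   ⇔ M ≥ 0 ∧ P ≥ 0 ∧ P² ≥ (128 k(k-1) n)² · 2k,  P = M² - 64 k(k-1)(k+2) n.

IneqM : ℕ → ℕ → ℤ
IneqM k n = + n ℤ.+ + 2 ℤ.* + k ℤ.- + 2 ℤ.- + 4 ℤ.* ((+ k ℤ.+ + 1) ℤ.* (+ k ℤ.+ + 1))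

IneqP : ℕ → ℕ → ℤ
IneqP k n = IneqM k n ℤ.* IneqM k n
  ℤ.- + 64 ℤ.* + k ℤ.* (+ k ℤ.- + 1) ℤ.* (+ k ℤ.+ + 2) ℤ.* + n

IneqB : ℕ → ℕ → ℤ
IneqB k n = + 128 ℤ.* + k ℤ.* (+ k ℤ.- + 1) ℤ.* + n

Ineq : ℕ → ℕ → Set
Ineq k n = (+ 0 ℤ.≤ IneqM k n) × (+ 0 ℤ.≤ IneqP k n) ×
  (IneqB k n ℤ.* IneqB k n ℤ.* (+ 2 ℤ.* + k) ℤ.≤ IneqP k n ℤ.* IneqP k n)

IsN1 : ℕ → ℕ → Set
IsN1 k m = (1 ℕ.≤ m) × ((n : ℕ) → m ℕ.≤ n → Ineq k n) ×
  ((m' : ℕ) → 1 ℕ.≤ m' → ((n : ℕ) → m' ℕ.≤ n → Ineq k n) → m ℕ.≤ m')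

-- The graph G'_{k,n}, n = 3 + 2a.  Vertex set Fin (3 + (a + a)):
-- first 3 vertices = A₀ = {u, v₁, v₂} (u = 0, v₁ = 1, v₂ = 2),
-- next a vertices = A₁, last a vertices = A₂.

Vtx : ℕ → Set
Vtx a = Fin 3 ⊎ (Fin a ⊎ Fin a)

classify : ∀ a → Fin (3 + (a + a)) → Vtx a
classify a v with splitAt 3 v
... | inj₁ i = inj₁ i
... | inj₂ w = inj₂ (splitAt a w)

eqF : ∀ {m} → Fin m → Fin m → Bool
eqF i j = ⌊ i ≟ j ⌋

adjV : ∀ {a} → Subset a → Subset a → Vtx a → Vtx a → Bool
adjV W₁ W₂ (inj₁ i) (inj₁ j) = not (eqF i j)
adjV W₁ W₂ (inj₂ (inj₁ x)) (inj₂ (inj₁ y)) = not (eqF x y)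
adjV W₁ W₂ (inj₂ (inj₂ x)) (inj₂ (inj₂ y)) = not (eqF x y)
adjV W₁ W₂ (inj₁ zero) (inj₂ (inj₁ w)) = lookup W₁ w
adjV W₁ W₂ (inj₂ (inj₁ w)) (inj₁ zero) = lookup W₁ w
adjV W₁ W₂ (inj₁ (suc _)) (inj₂ (inj₂ w)) = lookup W₂ w
adjV W₁ W₂ (inj₂ (inj₂ w)) (inj₁ (suc _)) = lookup W₂ w
adjV W₁ W₂ _ _ = false

G′ : (a : ℕ) → Subset a → Subset a → Graph (3 + (a + a))
G′ a W₁ W₂ = record { adj = λ x y → adjV W₁ W₂ (classify a x) (classify a y) }

{-# OPTIONS --safe #-}
module Submission where

-- In G′ the only edges leaving A₁ go to u, the only edges leaving A₁ ∪ {u} are uv₁, uv₂,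
-- and the only edges leaving A₂ go to v₁ or v₂; so a spanning tree T joins u to A₁ and to
-- some vᵢ, and joins some vᵢ to A₂.  Now u, v₁, v₂ all have degree k + 1 in G′, so a vertex
-- among them with two T-neighbours avoids degrees 2, …, k only if T contains all its
-- G′-edges.  Applied to u this puts uv₁ and uv₂ into T, applied to the vᵢ adjacent to A₂
-- it puts v₁v₂ into T: the triangle u v₁ v₂ lies in T.

open import Defs
open import Data.Nat using (ℕ; zero; suc; _≤_; _<_; _+_; _*_; _∸_; z≤n; s≤s)
open import Data.Fin.Subset using (Subset; ∣_∣)
open import Data.Nat.Properties
  using (+-0-monoid; ≤-trans; <⇒≱; ≰⇒>; +-mono-≤; +-mono-<-≤; +-mono-≤-<;
         +-monoʳ-≤; m≤m+n; m≤n+m; +-comm; +-assoc; +-identityʳ)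
import Data.Nat.ListAction as List
open import Algebra.Properties.Monoid.Sum +-0-monoid
  using (sum; sum-syntax; sum-replicate-zero)
open import Data.Fin using (Fin; zero; suc; splitAt; join)
open import Data.Fin.Properties using (splitAt-join; join-splitAt)
open import Data.Vec using ([]; _∷_; lookup)
open import Data.List using ([]; _∷_; tabulate)
open import Data.List.Properties using (map-tabulate)
open import Data.List.Relation.Unary.AllPairs using ([]; _∷_)
open import Data.List.Relation.Unary.All using ([]; _∷_)
open import Data.Bool using (Bool; true; false; if_then_else_)
open import Data.Sum as Sum using (_⊎_; inj₁; inj₂; map₁; map₂)
open import Data.Product using (Σ; _×_; _,_; proj₁)
open import Data.Unit using (tt)
open import Function using (_∘_; id)
open import Relation.Nullary using (¬_; contradiction)
open import Relation.Binary.PropositionalEquality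
  using (_≡_; _≢_; refl; sym; trans; cong; cong₂; subst; subst₂; module ≡-Reasoning)

boolToℕ : Bool → ℕ
boolToℕ b = if b then 1 else 0

boolToℕ-mono : ∀ {b c} → (b ≡ true → c ≡ true) → boolToℕ b ≤ boolToℕ c
boolToℕ-mono {false} _ = z≤n
boolToℕ-mono {true} b⇒c rewrite b⇒c refl = s≤s z≤n

sum-mono-≤ : ∀ {n} {f g : Fin n → ℕ} → (∀ i → f i ≤ g i) → sum f ≤ sum g
sum-mono-≤ {zero} f≤g = z≤n
sum-mono-≤ {suc n} f≤g = +-mono-≤ (f≤g zero) (sum-mono-≤ (f≤g ∘ suc))

sum-mono-< : ∀ {n} {f g : Fin n → ℕ} → (∀ i → f i ≤ g i) → ∀ i → f i < g i → sum f < sum g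
sum-mono-< f≤g zero fi<gi = +-mono-<-≤ fi<gi (sum-mono-≤ (f≤g ∘ suc))
sum-mono-< f≤g (suc i) fi<gi = +-mono-≤-< (f≤g zero) (sum-mono-< (f≤g ∘ suc) i fi<gi)

term≤sum : ∀ {n} (f : Fin n → ℕ) i → f i ≤ sum f
term≤sum f zero = m≤m+n (f zero) _
term≤sum f (suc i) = ≤-trans (term≤sum (f ∘ suc) i) (m≤n+m _ (f zero))

two-terms≤sum : ∀ {n} (f : Fin n → ℕ) {i j} → i ≢ j → f i + f j ≤ sum f
two-terms≤sum f {zero} {zero} i≢j = contradiction refl i≢j
two-terms≤sum f {zero} {suc j} _ = +-monoʳ-≤ (f zero) (term≤sum (f ∘ suc) j)
two-terms≤sum f {suc i} {zero} _ =
  subst (_≤ sum f) (+-comm (f zero) (f (suc i))) (+-monoʳ-≤ (f zero) (term≤sum (f ∘ suc) i))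
two-terms≤sum f {suc i} {suc j} i≢j =
  ≤-trans (two-terms≤sum (f ∘ suc) (i≢j ∘ cong suc)) (m≤n+m _ (f zero))

sum-splitAt : ∀ m {n} (g : Fin m ⊎ Fin n → ℕ) →
  sum (g ∘ splitAt m) ≡ sum (g ∘ inj₁) + sum (g ∘ inj₂)
sum-splitAt zero g = refl
sum-splitAt (suc m) g = trans (cong (g (inj₁ zero) +_) (sum-splitAt m (g ∘ map₁ suc)))
                              (sym (+-assoc (g (inj₁ zero)) _ _))

sum-tabulate : ∀ {n} (f : Fin n → ℕ) → List.sum (tabulate f) ≡ sum f
sum-tabulate {zero} f = refl
sum-tabulate {suc n} f = cong (f zero +_) (sum-tabulate (f ∘ suc))

∣p∣≡∑lookup : ∀ {n} (p : Subset n) → ∣ p ∣ ≡ ∑[ i < n ] boolToℕ (lookup p i)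
∣p∣≡∑lookup [] = refl
∣p∣≡∑lookup (true ∷ p) = cong suc (∣p∣≡∑lookup p)
∣p∣≡∑lookup (false ∷ p) = ∣p∣≡∑lookup p

module _ {N : ℕ} where

  degree≡∑ : (G : Graph N) (x : Fin N) → degree G x ≡ ∑[ y < N ] boolToℕ (adj G x y)
  degree≡∑ G x = trans (cong List.sum (map-tabulate id (boolToℕ ∘ adj G x)))
                       (sum-tabulate (boolToℕ ∘ adj G x))

  degree-mono-< : ∀ {T G : Graph N} → Subgraph T G → ∀ {x y} →
    adj T x y ≡ false → adj G x y ≡ true → degree T x < degree G x
  degree-mono-< {T} {G} T⊆G {x} {y} Txy Gxy =
    subst₂ _<_ (sym (degree≡∑ T x)) (sym (degree≡∑ G x))
    (sum-mono-< (λ z → boolToℕ-mono (T⊆G x z)) y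
      (subst₂ _<_ (cong boolToℕ (sym Txy)) (cong boolToℕ (sym Gxy)) (s≤s z≤n)))

  degree-saturated : ∀ {T G : Graph N} → Subgraph T G → ∀ {x} → degree G x ≤ degree T x →
    ∀ {y} → adj G x y ≡ true → adj T x y ≡ true
  degree-saturated {T} T⊆G {x} G≤T {y} Gxy with adj T x y in Txy
  ... | true = refl
  ... | false = contradiction G≤T (<⇒≱ (degree-mono-< T⊆G Txy Gxy))

  2≤degree : ∀ (T : Graph N) {x y z} → y ≢ z → adj T x y ≡ true → adj T x z ≡ true →
    2 ≤ degree T x
  2≤degree T {x} y≢z Txy Txz = subst (2 ≤_) (sym (degree≡∑ T x))
    (subst (_≤ ∑[ w < N ] boolToℕ (adj T x w))
           (cong₂ _+_ (cong boolToℕ Txy) (cong boolToℕ Txz))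
           (two-terms≤sum (boolToℕ ∘ adj T x) y≢z))

  2kST-saturated : ∀ {k} {G T : Graph N} → Is2kST k G T → ∀ {x y z} → degree G x ≡ suc k →
    y ≢ z → adj T x y ≡ true → adj T x z ≡ true → ∀ {w} → adj G x w ≡ true → adj T x w ≡ true
  2kST-saturated {T = T} ((T⊆G , _) , no-small-degree) {x} dG y≢z Txy Txz =
    degree-saturated T⊆G (subst (_≤ degree T x) (sym dG) (≰⇒> (λ dT≤k →
      no-small-degree x (2≤degree T y≢z Txy Txz , dT≤k))))

  crossing-edge : ∀ {T : Graph N} (S : Fin N → Bool) {x y} → Walk T x y →
    S x ≡ true → S y ≡ false →
    Σ (Fin N) λ p → Σ (Fin N) λ q → S p ≡ true × S q ≡ false × adj T p q ≡ true
  crossing-edge S here Sx Sy = contradiction (trans (sym Sx) Sy) λ ()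
  crossing-edge S (step {y = y} Txy walk) Sx Sz with S y in Sy
  ... | true = crossing-edge S walk Sy Sz
  ... | false = _ , _ , Sx , Sy , Txy

  separated⇒≢ : (S : Fin N → Bool) {x y : Fin N} → S x ≡ true → S y ≡ false → x ≢ y
  separated⇒≢ S Sx Sy refl = contradiction (trans (sym Sx) Sy) λ ()

  triangle⇒HasCycle : ∀ (T : Graph N) {x y z} → x ≢ y → x ≢ z → y ≢ z →
    adj T x y ≡ true → adj T y z ≡ true → adj T z x ≡ true → HasCycle T
  triangle⇒HasCycle T {x} {y} {z} x≢y x≢z y≢z Txy Tyz Tzx =
    x , y ∷ z ∷ [] , (x≢y ∷ x≢z ∷ []) ∷ (y≢z ∷ []) ∷ [] ∷ [] , s≤s (s≤s z≤n) , Txy , Tyz , Tzx , tt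

module G′-Properties {a : ℕ} (W₁ W₂ : Subset a) where

  G : Graph (3 + (a + a))
  G = G′ a W₁ W₂

  u v₁ v₂ : Fin (3 + (a + a))
  u = zero
  v₁ = suc zero
  v₂ = suc (suc zero)

  unclassify : Vtx a → Fin (3 + (a + a))
  unclassify = join 3 (a + a) ∘ map₂ (join a a)

  classify-unclassify : ∀ c → classify a (unclassify c) ≡ c
  classify-unclassify (inj₁ zero) = refl
  classify-unclassify (inj₁ (suc zero)) = refl
  classify-unclassify (inj₁ (suc (suc zero))) = refl
  classify-unclassify (inj₂ s) = cong inj₂ (splitAt-join a a s)

  unclassify-classify : ∀ p → unclassify (classify a p) ≡ p
  unclassify-classify zero = refl
  unclassify-classify (suc zero) = refl
  unclassify-classify (suc (suc zero)) = refl
  unclassify-classify (suc (suc (suc z))) = cong (λ i → suc (suc (suc i))) (join-splitAt a a z)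

  classify-injective : ∀ {p q} → classify a p ≡ classify a q → p ≡ q
  classify-injective {p} {q} eq = begin
    p                         ≡⟨ sym (unclassify-classify p) ⟩
    unclassify (classify a p) ≡⟨ cong unclassify eq ⟩
    unclassify (classify a q) ≡⟨ unclassify-classify q ⟩
    q                         ∎
    where open ≡-Reasoning

  inA₁ inA₁∪u inA₂ : Vtx a → Bool
  inA₁ (inj₂ (inj₁ _)) = true
  inA₁ _ = false
  inA₁∪u (inj₁ zero) = true
  inA₁∪u (inj₂ (inj₁ _)) = true
  inA₁∪u _ = false
  inA₂ (inj₂ (inj₂ _)) = true
  inA₂ _ = false

  A₁⊆A₁∪u : ∀ c → inA₁ c ≡ true → inA₁∪u c ≡ true
  A₁⊆A₁∪u (inj₂ (inj₁ _)) _ = refl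
  A₁⊆A₁∪u (inj₁ _) ()
  A₁⊆A₁∪u (inj₂ (inj₂ _)) ()

  A₁-boundary : ∀ c d → adjV W₁ W₂ c d ≡ true → inA₁ c ≡ true → inA₁ d ≡ false →
    d ≡ inj₁ zero
  A₁-boundary (inj₂ (inj₁ _)) (inj₁ zero) _ _ _ = refl
  A₁-boundary (inj₂ (inj₁ _)) (inj₁ (suc _)) () _ _
  A₁-boundary (inj₂ (inj₁ _)) (inj₂ (inj₁ _)) _ _ ()
  A₁-boundary (inj₂ (inj₁ _)) (inj₂ (inj₂ _)) () _ _
  A₁-boundary (inj₁ _) _ _ () _
  A₁-boundary (inj₂ (inj₂ _)) _ _ () _

  A₁∪u-boundary : ∀ c d → adjV W₁ W₂ c d ≡ true → inA₁∪u c ≡ true → inA₁∪u d ≡ false →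
    c ≡ inj₁ zero
  A₁∪u-boundary (inj₁ zero) _ _ _ _ = refl
  A₁∪u-boundary (inj₂ (inj₁ _)) (inj₁ zero) _ _ ()
  A₁∪u-boundary (inj₂ (inj₁ _)) (inj₁ (suc _)) () _ _
  A₁∪u-boundary (inj₂ (inj₁ _)) (inj₂ (inj₁ _)) _ _ ()
  A₁∪u-boundary (inj₂ (inj₁ _)) (inj₂ (inj₂ _)) () _ _
  A₁∪u-boundary (inj₁ (suc _)) _ _ () _
  A₁∪u-boundary (inj₂ (inj₂ _)) _ _ () _

  A₂-boundary : ∀ c d → adjV W₁ W₂ c d ≡ true → inA₂ c ≡ true → inA₂ d ≡ false →
    d ≡ inj₁ (suc zero) ⊎ d ≡ inj₁ (suc (suc zero))
  A₂-boundary (inj₂ (inj₂ _)) (inj₁ (suc zero)) _ _ _ = inj₁ refl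
  A₂-boundary (inj₂ (inj₂ _)) (inj₁ (suc (suc zero))) _ _ _ = inj₂ refl
  A₂-boundary (inj₂ (inj₂ _)) (inj₁ zero) () _ _
  A₂-boundary (inj₂ (inj₂ _)) (inj₂ (inj₁ _)) () _ _
  A₂-boundary (inj₂ (inj₂ _)) (inj₂ (inj₂ _)) _ _ ()
  A₂-boundary (inj₁ _) _ _ () _
  A₂-boundary (inj₂ (inj₁ _)) _ _ () _

  degree-u : degree G u ≡ 2 + ∣ W₁ ∣
  degree-u = begin
    degree G u
      ≡⟨ degree≡∑ G u ⟩
    2 + ∑[ z < a + a ] boolToℕ (adjV W₁ W₂ (inj₁ zero) (inj₂ (splitAt a z)))
      ≡⟨ cong (2 +_) (sum-splitAt a (boolToℕ ∘ adjV W₁ W₂ (inj₁ zero) ∘ inj₂)) ⟩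
    2 + (∑[ w < a ] boolToℕ (lookup W₁ w) + ∑[ w < a ] 0)
      ≡⟨ cong₂ (λ s t → 2 + (s + t)) (sym (∣p∣≡∑lookup W₁)) (sum-replicate-zero a) ⟩
    2 + (∣ W₁ ∣ + 0)
      ≡⟨ cong (2 +_) (+-identityʳ ∣ W₁ ∣) ⟩
    2 + ∣ W₁ ∣
      ∎
    where open ≡-Reasoning

  ∑-vᵢ-to-A₁∪A₂ : ∀ i →
    ∑[ z < a + a ] boolToℕ (adjV W₁ W₂ (inj₁ (suc i)) (inj₂ (splitAt a z))) ≡ ∣ W₂ ∣
  ∑-vᵢ-to-A₁∪A₂ i = trans (sum-splitAt a (boolToℕ ∘ adjV W₁ W₂ (inj₁ (suc i)) ∘ inj₂))
    (cong₂ _+_ (sum-replicate-zero a) (sym (∣p∣≡∑lookup W₂)))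

  degree-v₁ : degree G v₁ ≡ 2 + ∣ W₂ ∣
  degree-v₁ = trans (degree≡∑ G v₁) (cong (2 +_) (∑-vᵢ-to-A₁∪A₂ zero))

  degree-v₂ : degree G v₂ ≡ 2 + ∣ W₂ ∣
  degree-v₂ = trans (degree≡∑ G v₂) (cong (2 +_) (∑-vᵢ-to-A₁∪A₂ (suc zero)))

  module _ {T : Graph (3 + (a + a))} (T⊆G : Subgraph T G) (T-simple : IsSimple T)
           (connected : Connected T) where

    transport-edge : ∀ {p q} p′ q′ → classify a p ≡ classify a p′ →
      classify a q ≡ classify a q′ → adj T p q ≡ true → adj T p′ q′ ≡ true
    transport-edge _ _ p≈p′ q≈q′ =
      subst₂ (λ x y → adj T x y ≡ true) (classify-injective p≈p′) (classify-injective q≈q′)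

    A₁-neighbour-of-u : Fin a → Σ _ λ q → inA₁ (classify a q) ≡ true × adj T u q ≡ true
    A₁-neighbour-of-u w
      with crossing-edge (inA₁ ∘ classify a) (connected (unclassify (inj₂ (inj₁ w))) u)
             (cong inA₁ (classify-unclassify (inj₂ (inj₁ w)))) refl
    ... | p , q , p∈A₁ , q∉A₁ , Tpq =
      p , p∈A₁ , trans (proj₁ T-simple u p)
                   (transport-edge p u refl (A₁-boundary _ _ (T⊆G p q Tpq) p∈A₁ q∉A₁) Tpq)

    neighbour-of-u-outside-A₁∪u :
      Σ _ λ v → inA₁∪u (classify a v) ≡ false × adj T u v ≡ true
    neighbour-of-u-outside-A₁∪u
      with crossing-edge (inA₁∪u ∘ classify a) (connected u v₁) refl refl
    ... | p , q , p∈S , q∉S , Tpq =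
      q , q∉S , transport-edge u q (A₁∪u-boundary _ _ (T⊆G p q Tpq) p∈S q∉S) refl Tpq

    A₂-neighbour-of-v₁-or-v₂ : Fin a →
      Σ _ λ r → inA₂ (classify a r) ≡ true × (adj T v₁ r ≡ true ⊎ adj T v₂ r ≡ true)
    A₂-neighbour-of-v₁-or-v₂ w
      with crossing-edge (inA₂ ∘ classify a) (connected (unclassify (inj₂ (inj₂ w))) u)
             (cong inA₂ (classify-unclassify (inj₂ (inj₂ w)))) refl
    ... | p , q , p∈A₂ , q∉A₂ , Tpq = p , p∈A₂ ,
      Sum.map (λ q≈v → trans (proj₁ T-simple v₁ p) (transport-edge p v₁ refl q≈v Tpq))
              (λ q≈v → trans (proj₁ T-simple v₂ p) (transport-edge p v₂ refl q≈v Tpq))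
              (A₂-boundary _ _ (T⊆G p q Tpq) p∈A₂ q∉A₂)

  no-2kST : ∀ {k} → Fin a → ∣ W₁ ∣ ≡ k → ∣ W₂ ∣ ≡ k → ¬ Has2kST (suc k) G
  no-2kST w ∣W₁∣≡k ∣W₂∣≡k
    (T , st@((T⊆G , T-simple@(T-sym , _) , connected , acyclic) , _)) =
    acyclic (triangle⇒HasCycle T (λ ()) (λ ()) (λ ()) Tuv₁ Tv₁v₂ (trans (T-sym v₂ u) Tuv₂))
    where
    saturated-u : ∀ {y} → adj G u y ≡ true → adj T u y ≡ true
    saturated-u with A₁-neighbour-of-u T⊆G T-simple connected w
                   | neighbour-of-u-outside-A₁∪u T⊆G T-simple connected
    ... | q , q∈A₁ , Tuq | v , v∉A₁∪u , Tuv =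
      2kST-saturated st (trans degree-u (cong (2 +_) ∣W₁∣≡k))
        (separated⇒≢ (inA₁∪u ∘ classify a) (A₁⊆A₁∪u _ q∈A₁) v∉A₁∪u) Tuq Tuv

    Tuv₁ : adj T u v₁ ≡ true
    Tuv₁ = saturated-u refl

    Tuv₂ : adj T u v₂ ≡ true
    Tuv₂ = saturated-u refl

    Tv₁v₂ : adj T v₁ v₂ ≡ true
    Tv₁v₂ with A₂-neighbour-of-v₁-or-v₂ T⊆G T-simple connected w
    ... | r , r∈A₂ , inj₁ Tv₁r = 2kST-saturated st (trans degree-v₁ (cong (2 +_) ∣W₂∣≡k))
            (separated⇒≢ (inA₂ ∘ classify a) r∈A₂ refl) Tv₁r (trans (T-sym v₁ u) Tuv₁) refl
    ... | r , r∈A₂ , inj₂ Tv₂r = trans (T-sym v₁ v₂) (2kST-saturated st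
            (trans degree-v₂ (cong (2 +_) ∣W₂∣≡k))
            (separated⇒≢ (inA₂ ∘ classify a) r∈A₂ refl) Tv₂r (trans (T-sym v₂ u) Tuv₂) refl)

mainTheorem9 : (k n₁ n a : ℕ) → 2 ≤ k → IsN1 k n₁ → n₁ ≤ n → n ≡ 3 + 2 * a →
    (W₁ W₂ : Subset a) → ∣ W₁ ∣ ≡ k ∸ 1 → ∣ W₂ ∣ ≡ k ∸ 1 →
    ¬ Has2kST k (G′ a W₁ W₂)
mainTheorem9 (suc zero) _ _ _ (s≤s ()) _ _ _ _ _ _ _
mainTheorem9 (suc (suc k)) _ _ zero _ _ _ _ [] _ () _
mainTheorem9 (suc k) _ _ (suc a) _ _ _ _ W₁ W₂ ∣W₁∣≡k ∣W₂∣≡k =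
  G′-Properties.no-2kST W₁ W₂ zero ∣W₁∣≡k ∣W₂∣≡k
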